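{- Let $F(X,Y)$ be a CNF formula and let $F^+(X,Y)$ be a CNF formula obtained from $F(X,Y)$ by adding some resolvents of clauses of $F$. Let $\boldsymbol{q}$ be a partial assignment to variables of $X$, and let $X' \subseteq X$ and $X'' \subseteq X$ be such that the variables assigned in $\boldsymbol{q}$, $X'$ and $X''$ do not overlap. Then, if the D-sequent $(F,X',\boldsymbol{q}) \rightarrow X''$ holds, the D-sequent $(F^+,X',\boldsymbol{q}) \rightarrow X''$ holds too. The converse is not true: $(F^+,X',\boldsymbol{q}) \rightarrow X''$ may hold while $(F,X',\boldsymbol{q}) \rightarrow X''$ does not.
   Context: Definitions used. A point is a complete assignment to the variables of a CNF formula $G(Z)$. For $Z'\subseteq Z$, a clause $C$ is a $Z'$-clause if it contains a variable of $Z'$. A point $\boldsymbol{p}$ with $G(\boldsymbol{p})=0$ is a $Z'$-boundary point of $G$ if every clause of $G$ falsified by $\boldsymbol{p}$ is a $Z'$-clause and this fails for every proper subset of $Z'$. A $Z''$-boundary point $\boldsymbol{p}$ with $Z''\subseteq Z'$ is $Z'$-removable iff no point obtained from $\boldsymbol{p}$ by changing values of variables of $Z'$ satisfies $G$; for $F(X,Y)$, "removable" means $X$-removable. The variables of $X'\subseteq X$ are redundant in $F(X,Y)$ if $F$ has no removable $X^*$-boundary point with $X^*\subseteq X'$. $F_{\boldsymbol{q}}$ denotes $F$ with the clauses satisfied by $\boldsymbol{q}$ removed and the literals falsified by $\boldsymbol{q}$ removed from the remaining clauses; $\mathit{Dis}(G,X')$ denotes $G$ with all $X'$-clauses discarded.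 The D-sequent $(F,X',\boldsymbol{q}) \rightarrow X''$ holds if the variables of $X'$ are redundant in $F_{\boldsymbol{q}}$ and the variables of $X''$ are redundant in $\mathit{Dis}(F_{\boldsymbol{q}},X')$. -}

module Defs where

open import Data.Nat using (ℕ)
open import Data.Bool using (Bool; true; false; not; if_then_else_)
open import Data.Maybe using (Maybe; just; nothing)
open import Data.Fin using (Fin)
open import Data.Fin.Subset using (Subset; _∈_; _∉_; _⊆_; _⊂_)
open import Data.Vec using (lookup)
open import Data.List using (List; filterᵇ; map)
open import Data.Bool.ListAction using (any)
open import Data.List.Relation.Unary.Any using (Any)
open import Data.List.Relation.Unary.All using (All)
open import Data.List.Membership.Propositional using () renaming (_∈_ to _∈ₗ_)
open import Data.Product using (_×_; _,_; Σ; ∃; proj₁; proj₂)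
open import Data.Sum using (_⊎_)
open import Relation.Binary.PropositionalEquality using (_≡_; _≢_)
open import Relation.Nullary using (¬_)
open import Function.Bundles using (_⇔_)

-- Variables of a formula are Fin n.  A literal is (variable , sign);
-- sign true = positive literal v, sign false = negative literal ¬v.
Lit : ℕ → Set
Lit n = Fin n × Bool

Clause : ℕ → Set
Clause n = List (Lit n)

CNF : ℕ → Set
CNF n = List (Clause n)

Point : ℕ → Set
Point n = Fin n → Bool

PartialAssignment : ℕ → Set
PartialAssignment n = Fin n → Maybe Bool

variable
  n : ℕ

litVal : Point n → Lit n → Bool
litVal p (v , s) = if s then p v else not (p v)

SatClause : Point n → Clause n → Set
SatClause p C = Any (λ l → litVal p l ≡ true) C

FalsifiedClause : Point n → Clause n → Set
FalsifiedClause p C = All (λ l → litVal p l ≡ false) C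

Sat : CNF n → Point n → Set
Sat G p = All (SatClause p) G

Unsat : CNF n → Point n → Set
Unsat G p = Any (FalsifiedClause p) G

IsZClause : Subset n → Clause n → Set
IsZClause Z C = Any (λ l → proj₁ l ∈ Z) C

FalsifiedAreZ : CNF n → Subset n → Point n → Set
FalsifiedAreZ G Z p = ∀ C → C ∈ₗ G → FalsifiedClause p C → IsZClause Z C

BoundaryPoint : CNF n → Subset n → Point n → Set
BoundaryPoint G Z p =
  Unsat G p × FalsifiedAreZ G Z p × (∀ Z₀ → Z₀ ⊂ Z → ¬ FalsifiedAreZ G Z₀ p)

AgreeOutside : Subset n → Point n → Point n → Set
AgreeOutside Z p p' = ∀ v → v ∉ Z → p v ≡ p' v

-- p is Z'-removable (p is assumed to be a Z''-boundary point, Z'' ⊆ Z'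
-- in uses below): no point obtained by changing Z'-variables satisfies G
Removable : CNF n → Subset n → Point n → Set
Removable G Z p = ¬ (Σ (Point _) λ p' → AgreeOutside Z p p' × Sat G p')

Redundant : (X : Subset n) → CNF n → Subset n → Set
Redundant X G X' =
  ∀ Xs p → Xs ⊆ X' → BoundaryPoint G Xs p → ¬ Removable G X p

litValQ : PartialAssignment n → Lit n → Maybe Bool
litValQ q (v , s) with q v
... | nothing = nothing
... | just b  = just (if s then b else not b)

isTrueM : Maybe Bool → Bool
isTrueM (just true) = true
isTrueM _ = false

isAssignedM : Maybe Bool → Bool
isAssignedM (just _) = true
isAssignedM nothing  = false

satByQ : PartialAssignment n → Clause n → Bool
satByQ q C = any (λ l → isTrueM (litValQ q l)) C

-- F_q : drop clauses satisfied by q, drop literals falsified by q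
-- (a literal of an assigned variable not satisfied by q is falsified)
restrict : PartialAssignment n → CNF n → CNF n
restrict q F =
  map (filterᵇ (λ l → not (isAssignedM (litValQ q l))))
      (filterᵇ (λ C → not (satByQ q C)) F)

Dis : CNF n → Subset n → CNF n
Dis G Z = filterᵇ (λ C → not (any (λ l → lookup Z (proj₁ l)) C)) G

DSequent : (X : Subset n) → CNF n → Subset n → PartialAssignment n → Subset n → Set
DSequent X F X' q X'' =
  Redundant X (restrict q F) X' × Redundant X (Dis (restrict q F) X') X''

IsResolvent : Clause n → Clause n → Clause n → Set
IsResolvent {n} C₁ C₂ R = Σ (Fin n) λ v →
    ((v , true) ∈ₗ C₁)
  × ((v , false) ∈ₗ C₂)
  × (∀ w s → (w , s) ∈ₗ C₁ → (w , not s) ∈ₗ C₂ → w ≡ v)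
  × (∀ l → (l ∈ₗ R) ⇔ (((l ∈ₗ C₁) × l ≢ (v , true)) ⊎ ((l ∈ₗ C₂) × l ≢ (v , false))))

AddsResolvents : CNF n → CNF n → Set
AddsResolvents F F⁺ = Σ (CNF _) λ Rs →
    (F⁺ ≡ F Data.List.++ Rs)
  × All (λ R → Σ (Clause _) λ C₁ → Σ (Clause _) λ C₂ →
          (C₁ ∈ₗ F) × (C₂ ∈ₗ F) × IsResolvent C₁ C₂ R) Rs

Assigned : PartialAssignment n → Fin n → Set
Assigned q v = Σ Bool λ b → q v ≡ just b

WellPlaced : (X : Subset n) → PartialAssignment n → Subset n → Subset n → Set
WellPlaced X q X' X'' =
    (∀ v → Assigned q v → v ∈ X)
  × (X' ⊆ X) × (X'' ⊆ X)
  × (∀ v → Assigned q v → v ∉ X')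
  × (∀ v → Assigned q v → v ∉ X'')
  × (∀ v → v ∈ X' → v ∉ X'')

module Submission where

-- Say p is X-repairable for H when some point agreeing with p outside X
-- satisfies H; a point is X-removable exactly when it is not repairable.
-- If Z is redundant in H, every point falsifying only Z-clauses of H is
-- repairable, since such a point lies above a minimal boundary point
-- (`minimal-boundary`, `redundant-repairs`).  Hence redundancy transfers from
-- H to any H⁺ ⊇ H whose models are repairable for H⁺ (`redundant-superset`).
-- For the D-sequent this is applied to F_q ⊆ F⁺_q and to
-- Dis(F_q,X') ⊆ Dis(F⁺_q,X'); the repairs come from soundness of resolution,
-- carried through the restriction by q via the point "q overriding p"
-- (`restrict-sat⁻`, `restrict-sat⁺`).  The arguments are by contradiction,
-- so repairs live in the double-negation monad, matching ¬ Removable.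

open import Defs
open import Data.Nat using (ℕ; zero; suc; _<_; s≤s)
open import Data.Nat.Properties using (≤-refl; ≤-trans)
open import Data.Fin using (zero)
open import Data.Fin.Subset using (Subset; _⊆_; _⊂_; ∣_∣; inside; outside)
open import Data.Fin.Subset.Properties using (⊆-trans; p⊂q⇒∣p∣<∣q∣)
open import Data.Bool using (Bool; true; false; not; T; T?)
open import Data.Bool.Properties using (T-≡)
open import Data.Bool.ListAction using (any)
open import Data.Maybe using (just; nothing; fromMaybe)
open import Data.Maybe.Properties using (just-injective)
open import Data.Vec using ([]; _∷_; lookup)
open import Data.Vec.Properties using (lookup⇒[]=)
open import Data.List using ([]; _∷_; _++_; filterᵇ)
open import Data.List.Relation.Unary.Any as Any using (here; there)
open import Data.List.Relation.Unary.Any.Properties using (any⁺; any⁻; singleton⁻)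
open import Data.List.Relation.Unary.All as All using ([]; _∷_)
open import Data.List.Relation.Unary.All.Properties using (++⁺) renaming (filter⁺ to All-filter⁺)
open import Data.List.Membership.Propositional using (find; lose) renaming (_∈_ to _∈ₗ_)
open import Data.List.Membership.Propositional.Properties using (∈-filter⁺; ∈-filter⁻)
open import Data.List.Relation.Binary.Subset.Propositional using () renaming (_⊆_ to _⊆ₗ_)
open import Data.List.Relation.Binary.Subset.Propositional.Properties
  using (map⁺; filter⁺′; xs⊆xs++ys)
open import Data.Product using (_×_; _,_; Σ; proj₁)
open import Data.Product.Properties using (≡-dec)
open import Data.Sum using (_⊎_; inj₁; inj₂)
open import Data.Empty using (⊥-elim)
open import Relation.Binary.PropositionalEquality using (_≡_; refl; sym; trans; subst)
open import Relation.Nullary using (¬_; Dec; yes; no)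
open import Relation.Nullary.Decidable using (¬¬-excluded-middle)
open import Relation.Nullary.Negation using (¬¬-map; negated-stable)
open import Function.Bundles using (Equivalence; mk⇔)
open import Function.Base using (id; _∘_)
open import Data.Unit using (tt)
import Data.Fin as Fin
import Data.Bool as Bool

private
  variable
    m : ℕ
    A B : Set
    X Z Zs : Subset m
    H H⁺ : CNF m
    p p′ : Point m
    C : Clause m

_>>=¬¬_ : ¬ ¬ A → (A → ¬ ¬ B) → ¬ ¬ B
a >>=¬¬ f = negated-stable (¬¬-map f a)

complementary-absurd : {b : Bool} → b ≡ true → ¬ not b ≡ true
complementary-absurd refl ()

T-false-absurd : {b : Bool} → T b → ¬ b ≡ false
T-false-absurd t refl = t

clause-sat-or-falsified : (p : Point m) (C : Clause m) →
                          SatClause p C ⊎ FalsifiedClause p C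
clause-sat-or-falsified p [] = inj₂ []
clause-sat-or-falsified p (l ∷ C) with litVal p l in eq
... | true = inj₁ (here eq)
... | false with clause-sat-or-falsified p C
...   | inj₁ sat = inj₁ (there sat)
...   | inj₂ fal = inj₂ (eq ∷ fal)

sat-or-unsat : (H : CNF m) (p : Point m) → Sat H p ⊎ Unsat H p
sat-or-unsat [] p = inj₁ []
sat-or-unsat (C ∷ H) p with clause-sat-or-falsified p C | sat-or-unsat H p
... | inj₂ fal | _        = inj₂ (here fal)
... | inj₁ _   | inj₂ uns = inj₂ (there uns)
... | inj₁ sat | inj₁ sats = inj₁ (sat ∷ sats)

sat-falsified-absurd : SatClause p C → ¬ FalsifiedClause p C
sat-falsified-absurd (here t) (f ∷ _) with trans (sym t) f
... | ()
sat-falsified-absurd (there sat) (_ ∷ fal) = sat-falsified-absurd sat fal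

Repairable : Subset m → CNF m → Point m → Set
Repairable X H p = Σ (Point _) λ p′ → AgreeOutside X p p′ × Sat H p′

repair-trans : AgreeOutside X p p′ → ¬ Removable H X p′ → ¬ Removable H X p
repair-trans agree = ¬¬-map λ { (p″ , agree′ , sat) →
  p″ , (λ v v∉X → trans (agree v v∉X) (agree′ v v∉X)) , sat }

falsified-are-Z-mono : H ⊆ₗ H⁺ → Zs ⊆ Z → FalsifiedAreZ H⁺ Zs p → FalsifiedAreZ H Z p
falsified-are-Z-mono H⊆H⁺ Zs⊆Z onlyZs C C∈H fal = Any.map Zs⊆Z (onlyZs C (H⊆H⁺ C∈H) fal)

-- A falsifying point whose falsified clauses are all Z-clauses lies above a
-- boundary point for some Z₀ ⊆ Z: shrink Z while the property persists.
-- The bound k on ∣ Z ∣ drives the recursion.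
minimal-boundary-below : (k : ℕ) → ∣ Z ∣ < k → Unsat H p → FalsifiedAreZ H Z p →
                         ¬ ¬ (Σ (Subset m) λ Z₀ → Z₀ ⊆ Z × BoundaryPoint H Z₀ p)
minimal-boundary-below zero () _ _
minimal-boundary-below {Z = Z} {H = H} {p = p} (suc k) (s≤s bound) unsat onlyZ noBoundary =
  ¬¬-excluded-middle shrinkable?
  where
  Shrinkable : Set
  Shrinkable = Σ (Subset _) λ Z₁ → Z₁ ⊂ Z × FalsifiedAreZ H Z₁ p

  shrinkable? : ¬ Dec Shrinkable
  shrinkable? (yes (Z₁ , Z₁⊂Z , onlyZ₁)) =
    minimal-boundary-below k (≤-trans (p⊂q⇒∣p∣<∣q∣ Z₁⊂Z) bound) unsat onlyZ₁
      (λ (Z₀ , Z₀⊆Z₁ , bnd) → noBoundary (Z₀ , ⊆-trans Z₀⊆Z₁ (proj₁ Z₁⊂Z) , bnd))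
  shrinkable? (no minimal) =
    noBoundary (Z , id , unsat , onlyZ , λ Z₀ Z₀⊂Z onlyZ₀ → minimal (Z₀ , Z₀⊂Z , onlyZ₀))

minimal-boundary : Unsat H p → FalsifiedAreZ H Z p →
                   ¬ ¬ (Σ (Subset m) λ Z₀ → Z₀ ⊆ Z × BoundaryPoint H Z₀ p)
minimal-boundary = minimal-boundary-below _ ≤-refl

model-repairs : Sat H p → ¬ Removable H X p
model-repairs {p = p} sat removable = removable (p , (λ _ _ → refl) , sat)

redundant-repairs : Redundant X H Z → FalsifiedAreZ H Z p → ¬ Removable H X p
redundant-repairs {H = H} {p = p} red onlyZ with sat-or-unsat H p
... | inj₁ sat   = model-repairs sat
... | inj₂ unsat = minimal-boundary unsat onlyZ >>=¬¬ λ (Z₀ , Z₀⊆Z , bnd) →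
                     red Z₀ p Z₀⊆Z bnd

-- Redundancy passes from H to a larger formula H⁺ as soon as every model
-- of H is repairable for H⁺: a boundary point of H⁺ falsifies only
-- Z-clauses of H, so it is repaired into a model of H, and then further.
redundant-superset : H ⊆ₗ H⁺ → (∀ p → Sat H p → ¬ Removable H⁺ X p) →
                     Redundant X H Z → Redundant X H⁺ Z
redundant-superset H⊆H⁺ liftModel red Xs p Xs⊆Z (_ , onlyXs , _) =
  redundant-repairs red (falsified-are-Z-mono H⊆H⁺ Xs⊆Z onlyXs) >>=¬¬ λ (p′ , agree , sat) →
  repair-trans agree (liftModel p′ sat)

isZClauseᵇ : Subset m → Clause m → Bool
isZClauseᵇ Z C = any (λ l → lookup Z (proj₁ l)) C

keptByDis : Subset m → Clause m → Bool
keptByDis Z C = not (isZClauseᵇ Z C)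

dis-⊆ : (Z : Subset m) → H ⊆ₗ H⁺ → Dis H Z ⊆ₗ Dis H⁺ Z
dis-⊆ Z = filter⁺′ (T? ∘ keptByDis Z) (T? ∘ keptByDis Z) id

sat⇒dis-sat : (Z : Subset m) → Sat H p → Sat (Dis H Z) p
sat⇒dis-sat Z = All-filter⁺ (T? ∘ keptByDis Z)

dis-sat⇒falsified-are-Z : Sat (Dis H Z) p → FalsifiedAreZ H Z p
dis-sat⇒falsified-are-Z {Z = Z} sat C C∈H fal with isZClauseᵇ Z C in isZ
... | true  = Any.map (λ {l} t → lookup⇒[]= (proj₁ l) Z (Equivalence.to T-≡ t))
                      (any⁻ _ C (subst T (sym isZ) tt))
... | false = ⊥-elim (sat-falsified-absurd (All.lookup sat C∈Dis) fal)
  where C∈Dis = ∈-filter⁺ (T? ∘ keptByDis Z) C∈H (subst (T ∘ not) (sym isZ) tt)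

_▷_ : PartialAssignment m → Point m → Point m
(q ▷ p) v = fromMaybe (p v) (q v)

unassigned : PartialAssignment m → Lit m → Bool
unassigned q l = not (isAssignedM (litValQ q l))

unassigned⇒free : (q : PartialAssignment m) (l : Lit m) →
                  T (unassigned q l) → litValQ q l ≡ nothing
unassigned⇒free q l free with litValQ q l
... | nothing = refl

free⇒unassigned : (q : PartialAssignment m) (l : Lit m) →
                  litValQ q l ≡ nothing → T (unassigned q l)
free⇒unassigned q l eq rewrite eq = tt

free⇒litVal-▷ : (q : PartialAssignment m) (p : Point m) (l : Lit m) →
                litValQ q l ≡ nothing → litVal (q ▷ p) l ≡ litVal p l
free⇒litVal-▷ q p (v , s) eq with q v
... | nothing = refl

assigned⇒litVal-▷ : (q : PartialAssignment m) (p : Point m) (l : Lit m) {b : Bool} →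
                    litValQ q l ≡ just b → litVal (q ▷ p) l ≡ b
assigned⇒litVal-▷ q p (v , s) eq with q v
... | just _ = just-injective eq

satByQ⇒sat-▷ : (q : PartialAssignment m) (p : Point m) → T (satByQ q C) → SatClause (q ▷ p) C
satByQ⇒sat-▷ {C = C} q p t with find (any⁻ _ C t)
... | l , l∈C , isTrue with litValQ q l in eq
... | just true = lose l∈C (assigned⇒litVal-▷ q p l eq)

restricted-clause-sat⁻ : (q : PartialAssignment m) (p : Point m) →
                         SatClause p (filterᵇ (unassigned q) C) → SatClause (q ▷ p) C
restricted-clause-sat⁻ q p sat with find sat
... | l , l∈ , t with ∈-filter⁻ (T? ∘ unassigned q) l∈
... | l∈C , free = lose l∈C (trans (free⇒litVal-▷ q p l (unassigned⇒free q l free)) t)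

restricted-clause-sat⁺ : (q : PartialAssignment m) (p : Point m) → satByQ q C ≡ false →
                         SatClause (q ▷ p) C → SatClause p (filterᵇ (unassigned q) C)
restricted-clause-sat⁺ q p notSatByQ sat with find sat
... | l , l∈C , t with litValQ q l in eq
... | nothing    = lose (∈-filter⁺ (T? ∘ unassigned q) l∈C (free⇒unassigned q l eq))
                        (trans (sym (free⇒litVal-▷ q p l eq)) t)
... | just false with trans (sym (assigned⇒litVal-▷ q p l eq)) t
...   | ()
restricted-clause-sat⁺ q p notSatByQ sat | l , l∈C , t | just true =
  ⊥-elim (T-false-absurd (any⁺ _ (lose l∈C (subst (T ∘ isTrueM) (sym eq) tt))) notSatByQ)

restrict-sat⁻ : (q : PartialAssignment m) (p : Point m) (F : CNF m) →
                Sat (restrict q F) p → Sat F (q ▷ p)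
restrict-sat⁻ q p [] _ = []
restrict-sat⁻ q p (C ∷ F) sat with satByQ q C in satByQ≡
... | true = satByQ⇒sat-▷ q p (subst T (sym satByQ≡) tt) ∷ restrict-sat⁻ q p F sat
restrict-sat⁻ q p (C ∷ F) (sat ∷ sats) | false =
  restricted-clause-sat⁻ q p sat ∷ restrict-sat⁻ q p F sats

restrict-sat⁺ : (q : PartialAssignment m) (p : Point m) (F : CNF m) →
                Sat F (q ▷ p) → Sat (restrict q F) p
restrict-sat⁺ q p [] _ = []
restrict-sat⁺ q p (C ∷ F) (sat ∷ sats) with satByQ q C in satByQ≡
... | true  = restrict-sat⁺ q p F sats
... | false = restricted-clause-sat⁺ q p satByQ≡ sat ∷ restrict-sat⁺ q p F sats

restrict-⊆ : (q : PartialAssignment m) → H ⊆ₗ H⁺ → restrict q H ⊆ₗ restrict q H⁺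
restrict-⊆ q H⊆H⁺ = map⁺ _ (filter⁺′ notSat? notSat? id H⊆H⁺)
  where notSat? = λ C → T? (not (satByQ q C))

_≟ₗ_ : (l l′ : Lit m) → Dec (l ≡ l′)
_≟ₗ_ = ≡-dec Fin._≟_ Bool._≟_

-- A point satisfying both parents satisfies the resolvent: its true literals
-- in the parents cannot both be the clashing pair v, ¬v.
resolvent-sound : {C₁ C₂ R : Clause m} → IsResolvent C₁ C₂ R →
                  SatClause p C₁ → SatClause p C₂ → SatClause p R
resolvent-sound (v , _ , _ , _ , members) sat₁ sat₂ with find sat₁ | find sat₂
... | l₁ , l₁∈C₁ , t₁ | l₂ , l₂∈C₂ , t₂ with l₁ ≟ₗ (v , true) | l₂ ≟ₗ (v , false)
... | no l₁≢v | _ = lose (Equivalence.from (members l₁) (inj₁ (l₁∈C₁ , l₁≢v))) t₁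
... | yes _ | no l₂≢¬v = lose (Equivalence.from (members l₂) (inj₂ (l₂∈C₂ , l₂≢¬v))) t₂
... | yes refl | yes refl = ⊥-elim (complementary-absurd t₁ t₂)

adds-resolvents-sound : {F F⁺ : CNF m} → AddsResolvents F F⁺ → Sat F p → Sat F⁺ p
adds-resolvents-sound (_ , refl , resolvents) sat = ++⁺ sat (All.map
  (λ (_ , _ , C₁∈F , C₂∈F , res) → resolvent-sound res (All.lookup sat C₁∈F) (All.lookup sat C₂∈F))
  resolvents)

adds-resolvents-⊆ : {F F⁺ : CNF m} → AddsResolvents F F⁺ → F ⊆ₗ F⁺
adds-resolvents-⊆ {F = F} (Rs , refl , _) = xs⊆xs++ys F Rs

restricted-resolvents-sound : {F F⁺ : CNF m} (q : PartialAssignment m) →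
  AddsResolvents F F⁺ → Sat (restrict q F) p → Sat (restrict q F⁺) p
restricted-resolvents-sound {p = p} {F} {F⁺} q adds =
  restrict-sat⁺ q p F⁺ ∘ adds-resolvents-sound adds ∘ restrict-sat⁻ q p F

-- Both redundancy claims transfer by `redundant-superset`.  Models of
-- Dis(F_q,X') are repaired into models of F_q using redundancy of X' in F_q.
dsequent-preserved : (X : Subset m) {F F⁺ : CNF m} (q : PartialAssignment m) (X′ X″ : Subset m) →
  AddsResolvents F F⁺ → DSequent X F X′ q X″ → DSequent X F⁺ X′ q X″
dsequent-preserved X {F} {F⁺} q X′ X″ adds (red′ , red″) =
  redundant-superset F_q⊆F⁺_q (λ _ → model-repairs ∘ restricted-resolvents-sound q adds) red′ ,
  redundant-superset (dis-⊆ X′ F_q⊆F⁺_q) repairDis red″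
  where
  F_q⊆F⁺_q : restrict q F ⊆ₗ restrict q F⁺
  F_q⊆F⁺_q = restrict-⊆ q (adds-resolvents-⊆ adds)

  repairDis : ∀ p → Sat (Dis (restrict q F) X′) p → ¬ Removable (Dis (restrict q F⁺) X′) X p
  repairDis p sat = ¬¬-map (λ (p′ , agree , sat′) →
                              p′ , agree , sat⇒dis-sat X′ (restricted-resolvents-sound q adds sat′))
                           (redundant-repairs red′ (dis-sat⇒falsified-are-Z sat))

-- A formula containing the empty clause has no boundary points (the empty
-- clause is falsified but is not a Z-clause), so every set is redundant.
empty-clause⇒redundant : [] ∈ₗ H → Redundant X H Z
empty-clause⇒redundant □∈H _ _ _ (_ , onlyXs , _) with onlyXs [] □∈H []
... | ()

-- One variable x; F = {¬x, x}; F⁺ = F ∪ {□}, □ being their resolvent;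
-- q assigns nothing, X = X′ = {x}, X″ = ∅.
x-only : Subset 1
x-only = inside ∷ []

∅ : Subset 1
∅ = outside ∷ []

F-clash : CNF 1
F-clash = ((zero , false) ∷ []) ∷ ((zero , true) ∷ []) ∷ []

F-clash⁺ : CNF 1
F-clash⁺ = F-clash ++ ([] ∷ [])

q-empty : PartialAssignment 1
q-empty _ = nothing

□-resolvent : IsResolvent {1} ((zero , true) ∷ []) ((zero , false) ∷ []) []
□-resolvent = zero , here refl , here refl , (λ { zero _ _ _ → refl }) ,
  λ _ → mk⇔ (λ ()) λ { (inj₁ (here refl , ≢x)) → ⊥-elim (≢x refl)
                     ; (inj₂ (here refl , ≢¬x)) → ⊥-elim (≢¬x refl) }

F-clash-adds-□ : AddsResolvents F-clash F-clash⁺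
F-clash-adds-□ = [] ∷ [] , refl , (_ , _ , there (here refl) , here refl , □-resolvent) ∷ []

well-placed : WellPlaced x-only q-empty x-only ∅
well-placed = (λ _ ()) , id , (λ { {zero} () }) , (λ _ ()) , (λ _ ()) , (λ { zero _ () })

dsequent-F-clash⁺ : DSequent x-only F-clash⁺ x-only q-empty ∅
dsequent-F-clash⁺ = empty-clause⇒redundant (there (there (here refl))) ,
                    empty-clause⇒redundant (here refl)

-- The all-true point falsifies only ¬x, so it is an {x}-boundary point of F;
-- it is removable since F is unsatisfiable.
no-dsequent-F-clash : ¬ DSequent x-only F-clash x-only q-empty ∅
no-dsequent-F-clash (red , _) = red x-only allTrue id boundary removable
  where
  allTrue : Point 1
  allTrue _ = true

  boundary : BoundaryPoint (restrict q-empty F-clash) x-only allTrue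
  boundary = here (refl ∷ []) ,
             (λ { _ (here refl) _ → here (lookup⇒[]= zero x-only refl)
                ; _ (there (here refl)) (() ∷ []) }) ,
             λ { _ (_ , zero , _ , x∉Z₀) onlyZ₀ → x∉Z₀ (singleton⁻ (onlyZ₀ _ (here refl) (refl ∷ []))) }

  removable : Removable (restrict q-empty F-clash) x-only allTrue
  removable (p , _ , ¬x-sat ∷ x-sat ∷ []) =
    complementary-absurd (singleton⁻ x-sat) (singleton⁻ ¬x-sat)

-- The first part does not need the placement hypotheses WellPlaced.
proposition6 :
    (∀ (n : ℕ) (X : Subset n) (F F⁺ : CNF n) (q : PartialAssignment n) (X' X'' : Subset n) →
       AddsResolvents F F⁺ → WellPlaced X q X' X'' →
       DSequent X F X' q X'' → DSequent X F⁺ X' q X'')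
    × Σ ℕ (λ n → Σ (Subset n) λ X → Σ (CNF n) λ F → Σ (CNF n) λ F⁺ →
        Σ (PartialAssignment n) λ q → Σ (Subset n) λ X' → Σ (Subset n) λ X'' →
          AddsResolvents F F⁺ × WellPlaced X q X' X''
          × DSequent X F⁺ X' q X'' × ¬ DSequent X F X' q X'')
proposition6 =
  (λ _ X _ _ q X′ X″ adds _ → dsequent-preserved X q X′ X″ adds) ,
  (1 , x-only , F-clash , F-clash⁺ , q-empty , x-only , ∅ ,
   F-clash-adds-□ , well-placed , dsequent-F-clash⁺ , no-dsequent-F-clash)
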